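{- Let $G$ be a graphical regular representation of a finitely generated group. Then every periodic vertex-coloring, edge-coloring or orientation of $G$ is strongly periodic.
   Context: For a finitely generated group $\Gamma$ and finite generating set $S$ not containing the identity, $\mathrm{Cay}(\Gamma,S)$ has vertex set $\Gamma$ with $g,h$ adjacent iff $hg^{ -1}\in S\cup S^{ -1}$; $\Gamma$ acts on it by right multiplications. It is a graphical regular representation of $\Gamma$ if its automorphism group consists exactly of these right multiplications. A coloring or orientation is periodic if the subgroup of $\mathrm{Aut}(G)$ of automorphisms preserving it (mapping vertices/edges to vertices/edges of the same color, or edges to edges with the same orientation) has finitely many orbits on $V(G)$; it is strongly periodic if that subgroup has finite index in $\mathrm{Aut}(G)$. -}

module Defs where

open import Level using (Level; _⊔_; suc)
open import Algebra.Bundles using (Group)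
open import Data.List using (List; foldr)
open import Data.List.Membership.Propositional using (_∈_)
open import Data.Product using (Σ; ∃; _×_; _,_)
open import Data.Sum using (_⊎_)
open import Data.Bool using (Bool)
open import Relation.Nullary using (¬_)
open import Relation.Binary.PropositionalEquality using (_≡_; _≢_)

module Cayley {c ℓ : Level} (Γ : Group c ℓ) (S : List (Group.Carrier Γ)) where
  open Group Γ

  InSym : Carrier → Set (c ⊔ ℓ)
  InSym x = Σ Carrier λ s → s ∈ S × (x ≈ s ⊎ x ≈ s ⁻¹)

  prod : List Carrier → Carrier
  prod = foldr _∙_ ε

  IsFiniteGeneratingSet : Set (c ⊔ ℓ)
  IsFiniteGeneratingSet =
    (¬ (Σ Carrier λ s → s ∈ S × s ≈ ε)) ×
    (∀ g → Σ (List Carrier) λ w → ((∀ {x} → x ∈ w → InSym x) × g ≈ prod w))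

  Adj : Carrier → Carrier → Set (c ⊔ ℓ)
  Adj g h = InSym (h ∙ g ⁻¹)

  record Automorphism : Set (c ⊔ ℓ) where
    field
      fun     : Carrier → Carrier
      cong    : ∀ {x y} → x ≈ y → fun x ≈ fun y
      inv     : Carrier → Carrier
      inv-cong : ∀ {x y} → x ≈ y → inv x ≈ inv y
      invˡ    : ∀ x → fun (inv x) ≈ x
      invʳ    : ∀ x → inv (fun x) ≈ x
      adj     : ∀ g h → Adj g h → Adj (fun g) (fun h)
      adj⁻    : ∀ g h → Adj (fun g) (fun h) → Adj g h
  open Automorphism public

  IsGRR : Set (c ⊔ ℓ)
  IsGRR = ∀ (φ : Automorphism) → Σ Carrier λ a → ∀ g → fun φ g ≈ g ∙ a

  -- For a predicate "φ preserves the structure" (defining a subgroup of Aut(G)):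
  -- finitely many orbits on V(G)
  Periodic : ∀ {k} → (Automorphism → Set k) → Set (c ⊔ ℓ ⊔ k)
  Periodic Pres = Σ (List Carrier) λ L → ∀ g →
    Σ Carrier λ r → r ∈ L × Σ Automorphism λ φ → Pres φ × fun φ r ≈ g

  -- finite index in Aut(G): finitely many left cosets α P cover Aut(G)
  StronglyPeriodic : ∀ {k} → (Automorphism → Set k) → Set (c ⊔ ℓ ⊔ k)
  StronglyPeriodic Pres = Σ (List Automorphism) λ L → ∀ (ψ : Automorphism) →
    Σ Automorphism λ α → α ∈ L × Σ Automorphism λ φ → Pres φ ×
      (∀ g → fun ψ g ≈ fun α (fun φ g))

  record VertexColoring {k} (C : Set k) : Set (c ⊔ ℓ ⊔ k) where
    field
      col      : Carrier → C
      col-cong : ∀ {x y} → x ≈ y → col x ≡ col y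
  open VertexColoring public

  PreservesV : ∀ {k} {C : Set k} → VertexColoring C → Automorphism → Set (c ⊔ k)
  PreservesV κ φ = ∀ g → col κ (fun φ g) ≡ col κ g

  record EdgeColoring {k} (C : Set k) : Set (c ⊔ ℓ ⊔ k) where
    field
      ecol      : Carrier → Carrier → C
      ecol-cong : ∀ {x x' y y'} → x ≈ x' → y ≈ y' → ecol x y ≡ ecol x' y'
      ecol-sym  : ∀ g h → Adj g h → ecol g h ≡ ecol h g
  open EdgeColoring public

  PreservesE : ∀ {k} {C : Set k} → EdgeColoring C → Automorphism → Set (c ⊔ ℓ ⊔ k)
  PreservesE κ φ = ∀ g h → Adj g h → ecol κ (fun φ g) (fun φ h) ≡ ecol κ g h

  -- orientations: dir g h ≡ true means the edge {g,h} is oriented g → h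
  record Orientation : Set (c ⊔ ℓ) where
    field
      dir      : Carrier → Carrier → Bool
      dir-cong : ∀ {x x' y y'} → x ≈ x' → y ≈ y' → dir x y ≡ dir x' y'
      dir-anti : ∀ g h → Adj g h → dir g h ≢ dir h g
  open Orientation public

  PreservesO : Orientation → Automorphism → Set (c ⊔ ℓ)
  PreservesO o φ = ∀ g h → Adj g h → dir o (fun φ g) (fun φ h) ≡ dir o g h

{-# OPTIONS --safe #-}
-- In a graphical regular representation, Aut(G) is Γ acting on itself by right
-- multiplications, so the orbits on V(G) of a subgroup H ≤ Aut(G) are the cosets of H
-- and finitely many orbits means finite index. Explicitly, if ψ = ρₐ and a⁻¹ = φ(r) = r b
-- with r among finitely many orbit representatives and φ = ρ_b ∈ H, then ψ = ρ_{r⁻¹} ∘ φ⁻¹.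
-- The only property of the three preservation subgroups used is closure under inverses.
module Submission where

open import Defs
open import Level using (Level; _⊔_)
open import Algebra.Bundles using (Group)
open import Data.List using (List; map)
open import Data.List.Membership.Propositional using (_∈_)
open import Data.List.Membership.Propositional.Properties using (∈-map⁺)
open import Data.Product using (Σ; _×_; _,_)
open import Data.Sum using (inj₁; inj₂)
open import Relation.Binary.PropositionalEquality as ≡ using (_≡_)
import Algebra.Properties.Group as GroupProperties
import Relation.Binary.Reasoning.Setoid as SetoidReasoning

module CayleyAutomorphisms {c ℓ : Level} (Γ : Group c ℓ) (S : List (Group.Carrier Γ)) where
  open Group Γ
  open Cayley Γ S
  open GroupProperties Γ
  open SetoidReasoning setoid

  InSym-resp : ∀ {x y} → x ≈ y → InSym x → InSym y
  InSym-resp x≈y (s , s∈S , inj₁ x≈s)   = s , s∈S , inj₁ (trans (sym x≈y) x≈s)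
  InSym-resp x≈y (s , s∈S , inj₂ x≈s⁻¹) = s , s∈S , inj₂ (trans (sym x≈y) x≈s⁻¹)

  Adj-resp : ∀ {g g′ h h′} → g ≈ g′ → h ≈ h′ → Adj g h → Adj g′ h′
  Adj-resp g≈g′ h≈h′ = InSym-resp (//-cong₂ h≈h′ g≈g′)

  x∙z//y∙z≈x//y : ∀ x y z → (x ∙ z) // (y ∙ z) ≈ x // y
  x∙z//y∙z≈x//y x y z = begin
    (x ∙ z) ∙ (y ∙ z) ⁻¹     ≈⟨ ∙-congˡ (⁻¹-anti-homo-∙ y z) ⟩
    (x ∙ z) ∙ (z ⁻¹ ∙ y ⁻¹)  ≈⟨ assoc (x ∙ z) (z ⁻¹) (y ⁻¹) ⟨
    ((x ∙ z) // z) ∙ y ⁻¹    ≈⟨ ∙-congʳ (//-rightDividesʳ z x) ⟩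
    x ∙ y ⁻¹                 ∎

  x//[y∙z]≈x//z//y : ∀ x y z → x // (y ∙ z) ≈ x // z // y
  x//[y∙z]≈x//z//y x y z = begin
    x ∙ (y ∙ z) ⁻¹     ≈⟨ ∙-congˡ (⁻¹-anti-homo-∙ y z) ⟩
    x ∙ (z ⁻¹ ∙ y ⁻¹)  ≈⟨ assoc x (z ⁻¹) (y ⁻¹) ⟨
    x // z // y        ∎

  rightMul : Carrier → Automorphism
  rightMul a = record
    { fun      = _∙ a
    ; cong     = ∙-congʳ
    ; inv      = _// a
    ; inv-cong = ∙-congʳ
    ; invˡ     = //-rightDividesˡ a
    ; invʳ     = //-rightDividesʳ a
    ; adj      = λ g h → InSym-resp (sym (x∙z//y∙z≈x//y h g a))
    ; adj⁻     = λ g h → InSym-resp (x∙z//y∙z≈x//y h g a)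
    }

  Aut⁻¹ : Automorphism → Automorphism
  Aut⁻¹ φ = record
    { fun      = inv φ
    ; cong     = inv-cong φ
    ; inv      = fun φ
    ; inv-cong = cong φ
    ; invˡ     = invʳ φ
    ; invʳ     = invˡ φ
    ; adj      = λ g h g~h →
        adj⁻ φ (inv φ g) (inv φ h) (Adj-resp (sym (invˡ φ g)) (sym (invˡ φ h)) g~h)
    ; adj⁻     = λ g h φ⁻¹g~φ⁻¹h →
        Adj-resp (invˡ φ g) (invˡ φ h) (adj φ (inv φ g) (inv φ h) φ⁻¹g~φ⁻¹h)
    }

  IsRightMulBy : Automorphism → Carrier → Set (c ⊔ ℓ)
  IsRightMulBy φ a = ∀ g → fun φ g ≈ g ∙ a

  inv-rightMul : ∀ φ {a} → IsRightMulBy φ a → ∀ g → inv φ g ≈ g // a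
  inv-rightMul φ {a} φ≗∙a g = begin
    inv φ g                 ≈⟨ inv-cong φ (//-rightDividesˡ a g) ⟨
    inv φ ((g // a) ∙ a)    ≈⟨ inv-cong φ (φ≗∙a (g // a)) ⟨
    inv φ (fun φ (g // a))  ≈⟨ invʳ φ (g // a) ⟩
    g // a                  ∎

  ClosedUnderInverse : ∀ {k} → (Automorphism → Set k) → Set (c ⊔ ℓ ⊔ k)
  ClosedUnderInverse Pres = ∀ φ → Pres φ → Pres (Aut⁻¹ φ)

  PreservesV-closedUnderInverse : ∀ {k} {C : Set k} (κ : VertexColoring C) →
    ClosedUnderInverse (PreservesV κ)
  PreservesV-closedUnderInverse κ φ pres g =
    ≡.trans (≡.sym (pres (inv φ g))) (col-cong κ (invˡ φ g))

  PreservesE-closedUnderInverse : ∀ {k} {C : Set k} (κ : EdgeColoring C) →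
    ClosedUnderInverse (PreservesE κ)
  PreservesE-closedUnderInverse κ φ pres g h g~h =
    ≡.trans (≡.sym (pres (inv φ g) (inv φ h) (adj (Aut⁻¹ φ) g h g~h)))
            (ecol-cong κ (invˡ φ g) (invˡ φ h))

  PreservesO-closedUnderInverse : (o : Orientation) → ClosedUnderInverse (PreservesO o)
  PreservesO-closedUnderInverse o φ pres g h g~h =
    ≡.trans (≡.sym (pres (inv φ g) (inv φ h) (adj (Aut⁻¹ φ) g h g~h)))
            (dir-cong o (invˡ φ g) (invˡ φ h))

  GRR∧periodic⇒stronglyPeriodic : ∀ {k} {Pres : Automorphism → Set k} →
    ClosedUnderInverse Pres → IsGRR → Periodic Pres → StronglyPeriodic Pres
  GRR∧periodic⇒stronglyPeriodic {Pres = Pres} closed grr (reps , orbit) =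
    cosetReps , decompose
    where
    cosetReps : List Automorphism
    cosetReps = map (λ r → rightMul (r ⁻¹)) reps

    decompose : ∀ ψ → Σ Automorphism λ α → α ∈ cosetReps ×
      Σ Automorphism λ φ → Pres φ × (∀ g → fun ψ g ≈ fun α (fun φ g))
    decompose ψ with grr ψ
    ... | a , ψ≗∙a with orbit (a ⁻¹)
    ... | r , r∈reps , φ , φ∈Pres , φr≈a⁻¹ with grr φ
    ... | b , φ≗∙b =
      rightMul (r ⁻¹) , ∈-map⁺ (λ r → rightMul (r ⁻¹)) r∈reps ,
      Aut⁻¹ φ , closed φ φ∈Pres , ψ≗ρr⁻¹∘φ⁻¹
      where
      a≈[r∙b]⁻¹ : a ≈ (r ∙ b) ⁻¹
      a≈[r∙b]⁻¹ = trans (sym (⁻¹-involutive a)) (⁻¹-cong (trans (sym φr≈a⁻¹) (φ≗∙b r)))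

      ψ≗ρr⁻¹∘φ⁻¹ : ∀ g → fun ψ g ≈ inv φ g // r
      ψ≗ρr⁻¹∘φ⁻¹ g = begin
        fun ψ g         ≈⟨ ψ≗∙a g ⟩
        g ∙ a           ≈⟨ ∙-congˡ a≈[r∙b]⁻¹ ⟩
        g // (r ∙ b)    ≈⟨ x//[y∙z]≈x//z//y g r b ⟩
        g // b // r     ≈⟨ ∙-congʳ (inv-rightMul φ φ≗∙b g) ⟨
        inv φ g // r    ∎

corollary2p6 : ∀ {c ℓ k : Level} (Γ : Group c ℓ) (S : List (Group.Carrier Γ)) →
    Cayley.IsFiniteGeneratingSet Γ S → Cayley.IsGRR Γ S →
    ((C : Set k) (κ : Cayley.VertexColoring Γ S C) →
        Cayley.Periodic Γ S (Cayley.PreservesV Γ S κ) →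
        Cayley.StronglyPeriodic Γ S (Cayley.PreservesV Γ S κ))
    × ((C : Set k) (κ : Cayley.EdgeColoring Γ S C) →
        Cayley.Periodic Γ S (Cayley.PreservesE Γ S κ) →
        Cayley.StronglyPeriodic Γ S (Cayley.PreservesE Γ S κ))
    × ((o : Cayley.Orientation Γ S) →
        Cayley.Periodic Γ S (Cayley.PreservesO Γ S o) →
        Cayley.StronglyPeriodic Γ S (Cayley.PreservesO Γ S o))
corollary2p6 Γ S _ grr =
    (λ C κ → GRR∧periodic⇒stronglyPeriodic (PreservesV-closedUnderInverse κ) grr)
  , (λ C κ → GRR∧periodic⇒stronglyPeriodic (PreservesE-closedUnderInverse κ) grr)
  , (λ o → GRR∧periodic⇒stronglyPeriodic (PreservesO-closedUnderInverse o) grr)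
  where open CayleyAutomorphisms Γ S
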